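{- Let $\sigma^{:}=(\sigma,\operatorname{col}_\sigma)$ and $\pi^{:}=(\pi,\operatorname{col}_\pi)$ be decorated permutations on $[n]$ with Grassmann conecklaces $J^{\sigma}$ and $J^{\pi}$. If $J^{\sigma}_i\subseteq J^{\pi}_i$ for all $i\in[n]$, then $$\{a\in[n]: \sigma(a)\neq\pi(a)\text{ or }\operatorname{col}_\sigma(a)\neq\operatorname{col}_\pi(a)\}=\bigcup_{i=1}^n\left(J^{\pi}_i\setminus J^{\sigma}_i\right).$$
   Context: For $i\in[n]$ the cyclic order $<_i$ is $i<_i i+1<_i\cdots<_i n<_i 1<_i\cdots<_i i-1$. A decorated permutation on $[n]$ is a pair $(\pi,\operatorname{col})$, $\pi$ a permutation of $[n]$, $\operatorname{col}:[n]\to\{0,1,-1\}$ with $\operatorname{col}(i)=0$ iff $\pi(i)\ne i$. Its Grassmann necklace is $I_i=\{j: j<_i\pi^{ -1}(j)\text{ or }\operatorname{col}(j)=-1\}$ and its Grassmann conecklace is $J_i=\pi^{ -1}(I_i)$ (equivalently, the $\leq_i$-Gale-maximum basis of the associated positroid). -}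

module Defs where

open import Data.Nat using (ℕ; _+_; _∸_; _<_)
open import Data.Nat using (_≤ᵇ_)
open import Data.Bool using (if_then_else_)
open import Data.Fin using (Fin; toℕ)
open import Data.Fin.Permutation using (Permutation′; _⟨$⟩ʳ_; _⟨$⟩ˡ_)
open import Data.Product using (_×_; Σ)
open import Data.Sum using (_⊎_)
open import Relation.Binary.PropositionalEquality using (_≡_; _≢_)
open import Relation.Nullary using (¬_)

-- Colours for fixed points: 0 (not a fixed point), 1, -1.
data Colour : Set where
  c0 c+1 c-1 : Colour

-- Elements of [n] are represented by Fin n (k ↦ k+1).
-- Position of j in the cyclic order starting at i: (j - i) mod n.
cpos : {n : ℕ} → Fin n → Fin n → ℕ
cpos {n} i j = if toℕ i ≤ᵇ toℕ j then toℕ j ∸ toℕ i else (n + toℕ j) ∸ toℕ i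

_<[_]_ : {n : ℕ} → Fin n → Fin n → Fin n → Set
j <[ i ] k = cpos i j < cpos i k

record DecoratedPerm (n : ℕ) : Set where
  field
    perm : Permutation′ n
    col  : Fin n → Colour
    col-spec : ∀ a → (col a ≡ c0 → perm ⟨$⟩ʳ a ≢ a) × (perm ⟨$⟩ʳ a ≢ a → col a ≡ c0)

open DecoratedPerm public

InNecklace : {n : ℕ} → DecoratedPerm n → Fin n → Fin n → Set
InNecklace d i j = (j <[ i ] (perm d ⟨$⟩ˡ j)) ⊎ (col d j ≡ c-1)

InConecklace : {n : ℕ} → DecoratedPerm n → Fin n → Fin n → Set
InConecklace d i a = InNecklace d i (perm d ⟨$⟩ʳ a)

{-# OPTIONS --safe #-}
module Submission where

-- For a fixed a, the set {i : a ∈ J_i} is the cyclic interval (a, π(a)] when a is moved,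
-- everything when a is a loop of colour -1, and nothing when it is a loop of colour +1.
-- This set depends only on (π(a), col(a)), which gives one direction; conversely it
-- determines (π(a), col(a)), so under J^σ_i ⊆ J^π_i a difference at a forces some i with
-- a ∈ J^π_i ∖ J^σ_i (membership being decidable, the index can be found by search).

open import Defs
open import Data.Nat using (ℕ; _+_; _<_; _≤_; _≤ᵇ_; _<?_)
open import Data.Nat.Properties
  using (≤⇒≤ᵇ; ≤ᵇ⇒≤; m∸n+n≡m; m≤m+n; ≤-refl; ≤-trans; <⇒≤; <-≤-trans; ≤-<-trans; <-trans;
         <-irrefl; <-asym; ≰⇒>; +-monoˡ-<; +-cancelˡ-<; +-cancelʳ-≡; n≢0⇒n>0; n≮0)
open import Data.Bool using (true; false)
open import Data.Unit using (tt)
open import Data.Empty using (⊥-elim)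
open import Data.Fin using (Fin; toℕ)
open import Data.Fin.Properties
  using (toℕ-injective; toℕ<n; any?) renaming (_≟_ to _≟ᶠ_; _≤?_ to _≤?ᶠ_; ≤∧≢⇒< to ≤∧≢⇒<ᶠ)
open import Data.Fin.Permutation using (_⟨$⟩ʳ_; _⟨$⟩ˡ_; inverseˡ)
open import Data.Product using (_×_; ∃-syntax; _,_; proj₁; proj₂)
open import Data.Sum using (_⊎_; inj₁; inj₂)
open import Function using (_∘_)
open import Function.Bundles using (_⇔_; mk⇔; Equivalence; Injection)
open import Function.Properties.Inverse using (↔⇒↣)
open import Function.Construct.Symmetry using (⇔-sym)
open import Relation.Binary.PropositionalEquality using (_≡_; _≢_; refl; sym; trans; subst; subst₂)
open import Relation.Nullary using (¬_; Dec; yes; no; ¬?; _×-dec_; _⊎-dec_; decidable-stable)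

<-transport : ∀ {a b k p q} → a < b → a + k ≡ p → b + k ≡ q → p < q
<-transport {k = k} a<b refl refl = +-monoˡ-< k a<b

module _ {n : ℕ} where

  cpos-≤ : {i j : Fin n} → toℕ i ≤ toℕ j → cpos i j + toℕ i ≡ toℕ j
  cpos-≤ {i} {j} i≤j with toℕ i ≤ᵇ toℕ j | ≤⇒≤ᵇ i≤j
  ... | true | _ = m∸n+n≡m i≤j

  cpos-> : {i j : Fin n} → toℕ j < toℕ i → cpos i j + toℕ i ≡ n + toℕ j
  cpos-> {i} {j} j<i with toℕ i ≤ᵇ toℕ j | ≤ᵇ⇒≤ (toℕ i) (toℕ j)
  ... | true  | i≤j = ⊥-elim (<-irrefl refl (<-≤-trans j<i (i≤j tt)))
  ... | false | _   = m∸n+n≡m (≤-trans (<⇒≤ (toℕ<n i)) (m≤m+n n (toℕ j)))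

  cpos-self : (i : Fin n) → cpos i i ≡ 0
  cpos-self i = +-cancelʳ-≡ (toℕ i) (cpos i i) 0 (cpos-≤ ≤-refl)

  cpos-≡0⇒≡ : {i j : Fin n} → cpos i j ≡ 0 → i ≡ j
  cpos-≡0⇒≡ {i} {j} eq with i ≤?ᶠ j
  ... | yes i≤j = toℕ-injective (subst (λ k → k + toℕ i ≡ toℕ j) eq (cpos-≤ i≤j))
  ... | no  i≰j = ⊥-elim (<-irrefl (subst (λ k → k + toℕ i ≡ n + toℕ j) eq (cpos-> (≰⇒> i≰j)))
                                   (<-≤-trans (toℕ<n i) (m≤m+n n (toℕ j))))

  start-<[] : {i j : Fin n} → i ≢ j → i <[ i ] j
  start-<[] {i} i≢j rewrite cpos-self i = n≢0⇒n>0 (i≢j ∘ cpos-≡0⇒≡)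

  ≮[]-start : (i j : Fin n) → ¬ (j <[ i ] i)
  ≮[]-start i j rewrite cpos-self i = n≮0

  n+k≮toℕ : ∀ {k} (z : Fin n) → ¬ (n + k < toℕ z)
  n+k≮toℕ {k} z h = <-irrefl refl (<-trans (toℕ<n z) (≤-<-trans (m≤m+n n k) h))

  -- In each case two of the equations cpos i j + i ≡ j (or n + j) turn the hypothesis into
  -- an inequality among x, y, z < n that contradicts the case assumptions.
  <[]-cyclic-asym : (x y z : Fin n) → x ≢ y → y <[ x ] z → ¬ (x <[ y ] z)
  <[]-cyclic-asym x y z x≢y h₁ h₂ with x ≤?ᶠ y | x ≤?ᶠ z | y ≤?ᶠ z
  ... | yes x≤y | yes x≤z | yes y≤z = n+k≮toℕ z (<-transport h₂ (cpos-> (≤∧≢⇒<ᶠ x≤y x≢y)) (cpos-≤ y≤z))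
  ... | yes x≤y | yes x≤z | no  y≰z = <-asym (≰⇒> y≰z) (<-transport h₁ (cpos-≤ x≤y) (cpos-≤ x≤z))
  ... | yes x≤y | no  x≰z | yes y≤z = <-irrefl refl (<-≤-trans (≰⇒> x≰z) (≤-trans x≤y y≤z))
  ... | yes x≤y | no  x≰z | no  y≰z =
    <-asym (≰⇒> x≰z) (+-cancelˡ-< n _ _ (<-transport h₂ (cpos-> (≤∧≢⇒<ᶠ x≤y x≢y)) (cpos-> (≰⇒> y≰z))))
  ... | no  x≰y | yes x≤z | yes y≤z = n+k≮toℕ z (<-transport h₁ (cpos-> (≰⇒> x≰y)) (cpos-≤ x≤z))
  ... | no  x≰y | yes x≤z | no  y≰z = <-irrefl refl (<-≤-trans (≰⇒> y≰z) (≤-trans (<⇒≤ (≰⇒> x≰y)) x≤z))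
  ... | no  x≰y | no  x≰z | yes y≤z = <-asym (≰⇒> x≰z) (<-transport h₂ (cpos-≤ (<⇒≤ (≰⇒> x≰y))) (cpos-≤ y≤z))
  ... | no  x≰y | no  x≰z | no  y≰z =
    <-asym (≰⇒> y≰z) (+-cancelˡ-< n _ _ (<-transport h₁ (cpos-> (≰⇒> x≰y)) (cpos-> (≰⇒> x≰z))))

ConecklaceCondition : {n : ℕ} → Fin n → Fin n → Fin n → Colour → Set
ConecklaceCondition i a b k = b <[ i ] a ⊎ (b ≡ a × k ≡ c-1)

_≟c-1 : (k : Colour) → Dec (k ≡ c-1)
c0  ≟c-1 = no λ ()
c+1 ≟c-1 = no λ ()
c-1 ≟c-1 = yes refl

module _ {n : ℕ} (d : DecoratedPerm n) where
  open Equivalence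

  perm-injective : {a b : Fin n} → perm d ⟨$⟩ʳ a ≡ perm d ⟨$⟩ʳ b → a ≡ b
  perm-injective = Injection.injective (↔⇒↣ (perm d))

  moved⇒c0 : {a : Fin n} → perm d ⟨$⟩ʳ a ≢ a → col d a ≡ c0
  moved⇒c0 {a} = proj₂ (col-spec d a)

  c-1⇒loop : {a : Fin n} → col d a ≡ c-1 → perm d ⟨$⟩ʳ a ≡ a
  c-1⇒loop {a} neg with perm d ⟨$⟩ʳ a ≟ᶠ a
  ... | yes loop = loop
  ... | no moved with trans (sym neg) (moved⇒c0 moved)
  ...   | ()

  loop-colour : {a : Fin n} → perm d ⟨$⟩ʳ a ≡ a → col d a ≡ c+1 ⊎ col d a ≡ c-1
  loop-colour {a} loop with col d a in eq
  ... | c0  = ⊥-elim (proj₁ (col-spec d a) eq loop)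
  ... | c+1 = inj₁ refl
  ... | c-1 = inj₂ refl

  -- J_i = π⁻¹(I_i) unfolds to a condition on π⁻¹(π a) = a and on col(π a); injectivity of π
  -- brings the colour condition back to a itself.
  InConecklace⇔condition : (i a : Fin n) →
    InConecklace d i a ⇔ ConecklaceCondition i a (perm d ⟨$⟩ʳ a) (col d a)
  InConecklace⇔condition i a = mk⇔ ⇒condition condition⇒
    where
    ⇒condition : InConecklace d i a → ConecklaceCondition i a (perm d ⟨$⟩ʳ a) (col d a)
    ⇒condition (inj₁ before) = inj₁ (subst (λ t → (perm d ⟨$⟩ʳ a) <[ i ] t) (inverseˡ (perm d)) before)
    ⇒condition (inj₂ neg) = let loop = perm-injective (c-1⇒loop neg) in
                    inj₂ (loop , subst (λ t → col d t ≡ c-1) loop neg)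

    condition⇒ : ConecklaceCondition i a (perm d ⟨$⟩ʳ a) (col d a) → InConecklace d i a
    condition⇒ (inj₁ before) =
      inj₁ (subst (λ t → (perm d ⟨$⟩ʳ a) <[ i ] t) (sym (inverseˡ (perm d))) before)
    condition⇒ (inj₂ (loop , neg)) = inj₂ (subst (λ t → col d t ≡ c-1) (sym loop) neg)

  InConecklace? : (i a : Fin n) → Dec (InConecklace d i a)
  InConecklace? i a = (cpos i (perm d ⟨$⟩ʳ a) <? cpos i (perm d ⟨$⟩ˡ (perm d ⟨$⟩ʳ a)))
                        ⊎-dec (col d (perm d ⟨$⟩ʳ a) ≟c-1)

  InConecklace-image : {a : Fin n} → perm d ⟨$⟩ʳ a ≢ a → InConecklace d (perm d ⟨$⟩ʳ a) a
  InConecklace-image {a} moved = from (InConecklace⇔condition (perm d ⟨$⟩ʳ a) a) (inj₁ (start-<[] moved))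

  InConecklace-moved : (i : Fin n) {a : Fin n} → perm d ⟨$⟩ʳ a ≢ a →
                       InConecklace d i a → (perm d ⟨$⟩ʳ a) <[ i ] a
  InConecklace-moved i {a} moved a∈J with to (InConecklace⇔condition i a) a∈J
  ... | inj₁ before     = before
  ... | inj₂ (loop , _) = ⊥-elim (moved loop)

  InConecklace-loop : (i : Fin n) {a : Fin n} → perm d ⟨$⟩ʳ a ≡ a →
                      InConecklace d i a → col d a ≡ c-1
  InConecklace-loop i {a} loop a∈J with to (InConecklace⇔condition i a) a∈J
  ... | inj₁ before    = ⊥-elim (<-irrefl refl (subst (λ t → t <[ i ] a) loop before))
  ... | inj₂ (_ , neg) = neg

  InConecklace-self : {a : Fin n} → InConecklace d a a → perm d ⟨$⟩ʳ a ≡ a × col d a ≡ c-1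
  InConecklace-self {a} a∈J with to (InConecklace⇔condition a a) a∈J
  ... | inj₁ before   = ⊥-elim (≮[]-start a (perm d ⟨$⟩ʳ a) before)
  ... | inj₂ neg-loop = neg-loop

  c-1-loop-InConecklace : (i : Fin n) {a : Fin n} → perm d ⟨$⟩ʳ a ≡ a → col d a ≡ c-1 →
                          InConecklace d i a
  c-1-loop-InConecklace i {a} loop neg = from (InConecklace⇔condition i a) (inj₂ (loop , neg))

c+1≢c-1 : c+1 ≢ c-1
c+1≢c-1 ()

module _ {n : ℕ} (σ π : DecoratedPerm n) {a : Fin n} where
  open Equivalence

  private
    σa πa : Fin n
    σa = perm σ ⟨$⟩ʳ a
    πa = perm π ⟨$⟩ʳ a

  InConecklace-transfer : perm σ ⟨$⟩ʳ a ≡ perm π ⟨$⟩ʳ a → col σ a ≡ col π a →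
                          ∀ i → InConecklace σ i a → InConecklace π i a
  InConecklace-transfer same-image same-colour i =
    from (InConecklace⇔condition π i a)
    ∘ subst₂ (ConecklaceCondition i a) same-image same-colour
    ∘ to (InConecklace⇔condition σ i a)

  moved-decoration-determined : perm σ ⟨$⟩ʳ a ≢ a →
    (∀ i → InConecklace σ i a ⇔ InConecklace π i a) →
    perm π ⟨$⟩ʳ a ≡ perm σ ⟨$⟩ʳ a × col π a ≡ col σ a
  moved-decoration-determined σ-moved same with πa ≟ᶠ a
  ... | yes π-loop = ⊥-elim (σ-moved (proj₁ (InConecklace-self σ (from (same a) a∈Jπ-a))))
    where
    a∈Jπ-a : InConecklace π a a
    a∈Jπ-a = c-1-loop-InConecklace π a π-loop
               (InConecklace-loop π σa π-loop (to (same σa) (InConecklace-image σ σ-moved)))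
  ... | no π-moved with πa ≟ᶠ σa
  ...   | yes same-image = same-image , trans (moved⇒c0 π π-moved) (sym (moved⇒c0 σ σ-moved))
  ...   | no  π≢σ = ⊥-elim (<[]-cyclic-asym πa σa a π≢σ
            (InConecklace-moved σ πa σ-moved (from (same πa) (InConecklace-image π π-moved)))
            (InConecklace-moved π σa π-moved (to (same σa) (InConecklace-image σ σ-moved))))

  loop-colour-determined : perm σ ⟨$⟩ʳ a ≡ a → perm π ⟨$⟩ʳ a ≡ a →
    (InConecklace σ a a ⇔ InConecklace π a a) → col σ a ≡ col π a
  loop-colour-determined σ-loop π-loop same with loop-colour σ σ-loop | loop-colour π π-loop
  ... | inj₁ σ+ | inj₁ π+ = trans σ+ (sym π+)
  ... | inj₂ σ- | inj₂ π- = trans σ- (sym π-)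
  ... | inj₁ σ+ | inj₂ π- = ⊥-elim (c+1≢c-1 (trans (sym σ+) (proj₂ (InConecklace-self σ a∈Jσ-a))))
    where
    a∈Jσ-a : InConecklace σ a a
    a∈Jσ-a = from same (c-1-loop-InConecklace π a π-loop π-)
  ... | inj₂ σ- | inj₁ π+ = ⊥-elim (c+1≢c-1 (trans (sym π+) (proj₂ (InConecklace-self π a∈Jπ-a))))
    where
    a∈Jπ-a : InConecklace π a a
    a∈Jπ-a = to same (c-1-loop-InConecklace σ a σ-loop σ-)

decoration-determined : {n : ℕ} (σ π : DecoratedPerm n) {a : Fin n} →
  (∀ i → InConecklace σ i a ⇔ InConecklace π i a) →
  perm σ ⟨$⟩ʳ a ≡ perm π ⟨$⟩ʳ a × col σ a ≡ col π a
decoration-determined σ π {a} same with perm σ ⟨$⟩ʳ a ≟ᶠ a | perm π ⟨$⟩ʳ a ≟ᶠ a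
... | no σ-moved | _ = let (same-image , same-colour) = moved-decoration-determined σ π σ-moved same
                       in sym same-image , sym same-colour
... | yes _ | no π-moved = moved-decoration-determined π σ π-moved (⇔-sym ∘ same)
... | yes σ-loop | yes π-loop =
  trans σ-loop (sym π-loop) , loop-colour-determined σ π σ-loop π-loop (same a)

DecorationsDiffer : {n : ℕ} → DecoratedPerm n → DecoratedPerm n → Fin n → Set
DecorationsDiffer σ π a = (perm σ ⟨$⟩ʳ a ≢ perm π ⟨$⟩ʳ a) ⊎ (col σ a ≢ col π a)

SeparatingIndex : {n : ℕ} → DecoratedPerm n → DecoratedPerm n → Fin n → Set
SeparatingIndex σ π a = ∃[ i ] (InConecklace π i a × ¬ InConecklace σ i a)

separatingIndex⇒differ : {n : ℕ} (σ π : DecoratedPerm n) {a : Fin n} →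
  SeparatingIndex σ π a → DecorationsDiffer σ π a
separatingIndex⇒differ σ π {a} (i , a∈Jπ , a∉Jσ) with perm σ ⟨$⟩ʳ a ≟ᶠ perm π ⟨$⟩ʳ a
... | no  ≢-image    = inj₁ ≢-image
... | yes same-image = inj₂ λ same-colour →
        a∉Jσ (InConecklace-transfer π σ (sym same-image) (sym same-colour) i a∈Jπ)

agree⇒¬differ : {n : ℕ} (σ π : DecoratedPerm n) {a : Fin n} →
  perm σ ⟨$⟩ʳ a ≡ perm π ⟨$⟩ʳ a × col σ a ≡ col π a → ¬ DecorationsDiffer σ π a
agree⇒¬differ σ π (same-image , _) (inj₁ ≢-image) = ≢-image same-image
agree⇒¬differ σ π (_ , same-colour) (inj₂ ≢-colour) = ≢-colour same-colour

¬separatingIndex⇒sameMembership : {n : ℕ} (σ π : DecoratedPerm n) →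
  (∀ i a → InConecklace σ i a → InConecklace π i a) →
  ∀ {a} → ¬ SeparatingIndex σ π a → ∀ i → InConecklace σ i a ⇔ InConecklace π i a
¬separatingIndex⇒sameMembership σ π σ⊆π {a} none i = mk⇔ (σ⊆π i a) λ a∈Jπ →
  decidable-stable (InConecklace? σ i a) (λ a∉Jσ → none (i , a∈Jπ , a∉Jσ))

differ⇒separatingIndex : {n : ℕ} (σ π : DecoratedPerm n) →
  (∀ i a → InConecklace σ i a → InConecklace π i a) →
  ∀ {a} → DecorationsDiffer σ π a → SeparatingIndex σ π a
differ⇒separatingIndex σ π σ⊆π {a} differ
  with any? (λ i → InConecklace? π i a ×-dec ¬? (InConecklace? σ i a))
... | yes separating = separating
... | no none = ⊥-elim (agree⇒¬differ σ π agree differ)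
  where
  agree : perm σ ⟨$⟩ʳ a ≡ perm π ⟨$⟩ʳ a × col σ a ≡ col π a
  agree = decoration-determined σ π (¬separatingIndex⇒sameMembership σ π σ⊆π none)

lemma3p16 : (n : ℕ) (σ π : DecoratedPerm n) →
    (∀ i a → InConecklace σ i a → InConecklace π i a) →
    ∀ a → ((perm σ ⟨$⟩ʳ a ≢ perm π ⟨$⟩ʳ a) ⊎ (col σ a ≢ col π a))
          ⇔ (∃[ i ] (InConecklace π i a × ¬ InConecklace σ i a))
lemma3p16 _ σ π σ⊆π a = mk⇔ (differ⇒separatingIndex σ π σ⊆π) (separatingIndex⇒differ σ π)
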